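{- Let $G$ be a simple graph of order $n\ge 2$. If $G$ is acyclic, then $S[G,t]$ is acyclic for every $t\ge1$. Moreover, if $G$ contains $l$ cycles of order $k$, then for every $t\ge 1$, $S[G,t]$ contains at least $l\,n^{t-1}$ cycles of order $k$.
   Context: Let $G$ be a simple graph with vertex set $V=\{1,\dots,n\}$, $n\ge 2$. For $t\ge 1$, the generalized Sierpiński graph $S(G,t)$ has vertex set $V^t$ (words $u_1u_2\cdots u_t$ over $V$), and two words ${\bf u}=u_1\cdots u_t$, ${\bf v}=v_1\cdots v_t$ are adjacent iff there is $i\in\{1,\dots,t\}$ with $u_j=v_j$ for $j<i$, $u_i\neq v_i$ and $u_iv_i\in E(G)$, and $u_j=v_i$, $v_j=u_i$ for all $j>i$. An edge of this kind with $i<t$ is called a linking edge. The generalized Sierpiński gasket $S[G,t]$ is the graph obtained from $S(G,t)$ by contracting all linking edges (so $S[G,1]=G$). -}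

module Defs where

open import Level using (0ℓ)
open import Data.Nat using (ℕ; zero; suc; _≤_; _<_)
open import Data.Fin as F using (Fin; zero; suc; toℕ)
open import Data.Vec using (Vec; lookup)
open import Data.Product using (Σ; ∃; ∃₂; _×_; _,_)
open import Data.Sum using (_⊎_)
open import Relation.Nullary using (¬_)
open import Relation.Binary.PropositionalEquality using (_≡_; _≢_)
open import Relation.Binary.Construct.Closure.Equivalence using (EqClosure)

record SimpleGraph (n : ℕ) : Set₁ where
  field
    Adj   : Fin n → Fin n → Set
    sym   : ∀ {x y} → Adj x y → Adj y x
    irrefl : ∀ {x} → ¬ Adj x x
open SimpleGraph public

cnext : ∀ {k} → Fin k → Fin k
cnext {suc zero} zero = zero
cnext {suc (suc m)} zero = suc zero
cnext {suc (suc m)} (suc i) with cnext {suc m} i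
... | zero = zero
... | suc j = suc (suc j)

IsCycle : {V : Set} → (V → V → Set) → (V → V → Set) → (k : ℕ) → (Fin k → V) → Set
IsCycle _≈_ Adj k c =
  (3 ≤ k) × (∀ i j → c i ≈ c j → i ≡ j) × (∀ i → Adj (c i) (c (cnext i)))

UPairEq : {V : Set} → (V → V → Set) → V → V → V → V → Set
UPairEq _≈_ a b a' b' = (a ≈ a' × b ≈ b') ⊎ (a ≈ b' × b ≈ a')

-- two cycles are the same cycle (subgraph) iff they have the same edge set
SameCycle : {V : Set} → (V → V → Set) → {k : ℕ} → (Fin k → V) → (Fin k → V) → Set
SameCycle _≈_ c d =
  (∀ i → ∃ λ j → UPairEq _≈_ (c i) (c (cnext i)) (d j) (d (cnext j))) ×
  (∀ j → ∃ λ i → UPairEq _≈_ (d j) (d (cnext j)) (c i) (c (cnext i)))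

HasDistinctCycles : {V : Set} → (V → V → Set) → (V → V → Set) → (k l : ℕ) → Set
HasDistinctCycles {V} _≈_ Adj k l =
  Σ (Fin l → Fin k → V) λ cs →
    (∀ a → IsCycle _≈_ Adj k (cs a)) ×
    (∀ a b → SameCycle _≈_ (cs a) (cs b) → a ≡ b)

Acyclic : {V : Set} → (V → V → Set) → (V → V → Set) → Set
Acyclic {V} _≈_ Adj = ∀ k (c : Fin k → V) → ¬ IsCycle _≈_ Adj k c

-- Generalized Sierpiński graph S(G,t): words of length t over Fin n

Word : ℕ → ℕ → Set
Word n t = Vec (Fin n) t

module _ {n : ℕ} (G : SimpleGraph n) {t : ℕ} where

  -- u and v adjacent in S(G,t) via position i (0-based here)
  SAdjAt : Word n t → Word n t → Fin t → Set
  SAdjAt u v i =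
    (∀ j → j F.< i → lookup u j ≡ lookup v j) ×
    (lookup u i ≢ lookup v i) ×
    Adj G (lookup u i) (lookup v i) ×
    (∀ j → i F.< j → (lookup u j ≡ lookup v i) × (lookup v j ≡ lookup u i))

  SAdj : Word n t → Word n t → Set
  SAdj u v = ∃ λ i → SAdjAt u v i

  -- linking edges: position i < t (1-based), i.e. not the last position
  Linking : Word n t → Word n t → Set
  Linking u v = ∃ λ i → SAdjAt u v i × suc (toℕ i) < t

  -- Generalized Sierpiński gasket S[G,t]: contract all linking edges.
  -- Vertices: words modulo the equivalence generated by linking edges.
  _∼_ : Word n t → Word n t → Set
  _∼_ = EqClosure Linking

  -- Two classes are adjacent iff distinct and some representatives are
  -- adjacent in S(G,t) (simple graph: loops / parallel edges are dropped).
  GAdj : Word n t → Word n t → Set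
  GAdj u v = ¬ (u ∼ v) × ∃₂ λ u' v' → (u ∼ u') × (v ∼ v') × SAdj u' v'

{-# OPTIONS --safe #-}
module Submission where

-- Every edge of S[G,t] is represented by an edge of S(G,t) at the last position, and a word has at
-- most one linking neighbour, so the vertices of S[G,t] are classes of at most two words.
--
-- Acyclicity: take representatives U i of the vertices of a cycle of S[G,t] and the first position q
-- at which they do not all agree. If q is the last position, the last letters of the U i form a cycle
-- of G. Otherwise the letters of the U i at position q form a closed walk in G that moves only along
-- linking edges at position q. Such an edge is determined by the common prefix and its two letters,
-- and it lies inside a single vertex of the cycle, so the walk never reuses an edge of G: it is a
-- non-constant closed trail, hence contains a cycle.
--
-- Cycles: for a prefix w of length t - 1 the words w x form a copy of G in S[G,t]. A vertex w x is
-- identified with a vertex of another copy w′ only if x is the last letter of w or of w′; as a cycle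
-- has at least three vertices, the l n^(t-1) lifted cycles are pairwise distinct.

open import Defs hiding (sym)
open import Data.Nat using (ℕ; zero; suc; _+_; _*_; _^_; _∸_; _≤_; _<_; z≤n; s≤s; s≤s⁻¹; z<s)
open import Data.Nat.Properties
open import Data.Fin as F using (Fin; zero; suc; toℕ; fromℕ; fromℕ<; inject₁)
open import Data.Fin.Properties
  using ( toℕ-injective; toℕ<n; toℕ-fromℕ; toℕ-fromℕ<; toℕ-inject₁; ≤fromℕ
        ; all?; ¬∀⟶∃¬; pigeonhole; combine-remQuot)
open import Data.Vec using (Vec; []; _∷_; _∷ʳ_; lookup)
open import Data.Vec.Properties
  using (tabulate∘lookup; tabulate-cong; ≡-dec; ∷-injectiveˡ; ∷-injectiveʳ
        ; ∷ʳ-injectiveˡ; ∷ʳ-injectiveʳ)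
open import Data.Product using (∃; ∃₂; _×_; _,_; proj₁; proj₂)
import Data.Product as Product
open import Data.Sum using (_⊎_; inj₁; inj₂)
import Data.Sum as Sum
open import Data.Empty using (⊥; ⊥-elim)
open import Function using (_∘_)
open import Relation.Nullary using (¬_; Dec; yes; no)
open import Relation.Nullary.Decidable using (¬?; _→-dec_; decidable-stable)
open import Relation.Unary using (Decidable)
open import Relation.Binary.Definitions using (DecidableEquality; Tri; tri<; tri≈; tri>)
open import Relation.Binary.PropositionalEquality
open import Relation.Binary.Construct.Closure.ReflexiveTransitive using (ε; _◅_; _◅◅_; return)
open import Relation.Binary.Construct.Closure.Symmetric using (fwd; bwd)
import Relation.Binary.Construct.Closure.Equivalence as EqClosure

toℕ-cnext : ∀ {k} (i : Fin k) →
  (suc (toℕ i) < k × toℕ (cnext i) ≡ suc (toℕ i)) ⊎ (suc (toℕ i) ≡ k × toℕ (cnext i) ≡ 0)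
toℕ-cnext {suc zero}    zero = inj₂ (refl , refl)
toℕ-cnext {suc (suc k)} zero = inj₁ (s≤s (s≤s z≤n) , refl)
toℕ-cnext {suc (suc k)} (suc i) with cnext {suc k} i | toℕ-cnext {suc k} i
... | zero  | inj₁ (_ , ())
... | zero  | inj₂ (i+1≡k , _) = inj₂ (cong suc i+1≡k , refl)
... | suc j | inj₁ (i+1<k , eq) = inj₁ (s≤s i+1<k , cong suc eq)
... | suc j | inj₂ (_ , ())

cnext-injective : ∀ {k} {i j : Fin k} → cnext i ≡ cnext j → i ≡ j
cnext-injective {i = i} {j} eq with toℕ-cnext i | toℕ-cnext j
... | inj₁ (_ , p) | inj₁ (_ , q) =
  toℕ-injective (suc-injective (trans (sym p) (trans (cong toℕ eq) q)))
... | inj₂ (p , _) | inj₂ (q , _) = toℕ-injective (suc-injective (trans p (sym q)))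
... | inj₁ (_ , p) | inj₂ (_ , q) with () ← trans (sym p) (trans (cong toℕ eq) q)
... | inj₂ (_ , p) | inj₁ (_ , q) with () ← trans (sym q) (trans (cong toℕ (sym eq)) p)

cnext-≢ : ∀ {k} → 2 ≤ k → (i : Fin k) → i ≢ cnext i
cnext-≢ 2≤k i eq with toℕ-cnext i
... | inj₁ (_ , toℕ-next)    = 1+n≢n (sym (trans (cong toℕ eq) toℕ-next))
... | inj₂ (i+1≡k , toℕ-next) =
  <-irrefl refl (subst (2 ≤_) (trans (sym i+1≡k) (cong suc (trans (cong toℕ eq) toℕ-next))) 2≤k)

cnext-iterate : ∀ {k} → ℕ → Fin (suc k)
cnext-iterate zero    = zero
cnext-iterate (suc r) = cnext (cnext-iterate r)

toℕ-cnext-iterate : ∀ {k r} → r < suc k → toℕ (cnext-iterate {k} r) ≡ r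
toℕ-cnext-iterate {r = zero} _ = refl
toℕ-cnext-iterate {k} {suc r} r+1<k+1
  with toℕ-cnext (cnext-iterate {k} r) | toℕ-cnext-iterate {k} {r} (<-trans (n<1+n r) r+1<k+1)
... | inj₁ (_ , eq) | ih = trans eq (cong suc ih)
... | inj₂ (eq , _) | ih = ⊥-elim (<-irrefl (trans (cong suc (sym ih)) eq) r+1<k+1)

cnext-iterate-period : ∀ k → cnext-iterate {k} (suc k) ≡ zero
cnext-iterate-period k with toℕ-cnext (cnext-iterate {k} k) | toℕ-cnext-iterate {k} {k} (n<1+n k)
... | inj₁ (k+1<k+1 , _) | ih = ⊥-elim (<-irrefl (cong suc ih) k+1<k+1)
... | inj₂ (_ , eq)      | _  = toℕ-injective eq

-- Closed trails contain cycles

skip : ℕ → ℕ → ℕ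
skip zero    r       = suc r
skip (suc m) zero    = zero
skip (suc m) (suc r) = suc (skip m r)

skip-injective : ∀ m {r r′} → skip m r ≡ skip m r′ → r ≡ r′
skip-injective zero    eq = suc-injective eq
skip-injective (suc m) {zero}  {zero}   _  = refl
skip-injective (suc m) {suc r} {suc r′} eq = cong suc (skip-injective m (suc-injective eq))

skip-≤ : ∀ m r → skip m r ≤ suc r
skip-≤ zero    r       = ≤-refl
skip-≤ (suc m) zero    = z≤n
skip-≤ (suc m) (suc r) = s≤s (skip-≤ m r)

skip-≥ : ∀ {m r} → m ≤ r → skip m r ≡ suc r
skip-≥ {zero}          _         = refl
skip-≥ {suc m} {suc r} (s≤s m≤r) = cong suc (skip-≥ m≤r)

skip-preimage : ∀ m {r} → r ≢ m → ∃ λ r′ → skip m r′ ≡ r × (r′ < r ⊎ r′ < m)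
skip-preimage zero    {zero}  r≢m = ⊥-elim (r≢m refl)
skip-preimage zero    {suc r} _   = r , refl , inj₁ (n<1+n r)
skip-preimage (suc m) {zero}  _   = zero , refl , inj₂ z<s
skip-preimage (suc m) {suc r} r≢m with skip-preimage m (r≢m ∘ cong suc)
... | r′ , eq , bound = suc r′ , cong suc eq , Sum.map s≤s s≤s bound

skip-start : ∀ {A : Set} (a : ℕ → A) m → a m ≡ a (suc m) → a (skip m 0) ≡ a 0
skip-start a zero    am≡am+1 = sym am≡am+1
skip-start a (suc m) _       = refl

skip-suc : ∀ {A : Set} (a : ℕ → A) m → a m ≡ a (suc m) →
  ∀ r → a (skip m (suc r)) ≡ a (suc (skip m r))
skip-suc a zero          _       r       = refl
skip-suc a (suc zero)    a1≡a2   zero    = sym a1≡a2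
skip-suc a (suc (suc m)) _       zero    = refl
skip-suc a (suc m)       am≡am+1 (suc r) = skip-suc (a ∘ suc) m am≡am+1 r

leastBelow : ∀ {P : ℕ → Set} → Decidable P → ∀ n → (∃ λ q → q < n × P q) →
  ∃ λ q → q < n × P q × (∀ {q′} → q′ < q → ¬ P q′)
leastBelow P? (suc n) (q , q<n+1 , Pq) with anyUpTo? P? n
... | yes smaller = Product.map₂ (Product.map₁ m<n⇒m<1+n) (leastBelow P? n smaller)
... | no none with m<1+n⇒m<n∨m≡n q<n+1
...   | inj₁ q<n  = ⊥-elim (none (q , q<n , Pq))
...   | inj₂ refl = q , q<n+1 , Pq , λ q′<q Pq′ → none (_ , q′<q , Pq′)

module ClosedTrails {V : Set} (_≟_ : DecidableEquality V) (R : V → V → Set) where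

  HasCycle : Set
  HasCycle = ∃₂ λ k (c : Fin k → V) → IsCycle _≡_ R k c

  Moves : (ℕ → V) → ℕ → Set
  Moves a r = a r ≢ a (suc r)

  SameStep : (ℕ → V) → ℕ → ℕ → Set
  SameStep a r r′ = UPairEq _≡_ (a r) (a (suc r)) (a r′) (a (suc r′))

  AllDistinctBelow : (ℕ → V) → ℕ → Set
  AllDistinctBelow a q = ∀ {i j} → i < q → j < q → a i ≡ a j → i ≡ j

  record ClosedTrail (L : ℕ) : Set where
    field
      walk   : ℕ → V
      closed : walk L ≡ walk 0
      step   : ∀ {r} → r < L → Moves walk r → R (walk r) (walk (suc r))
      trail  : ∀ {r r′} → r < L → r′ < L → Moves walk r → Moves walk r′ →
               SameStep walk r r′ → r ≡ r′

  Moving : ∀ {L} → ClosedTrail L → Set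
  Moving {L} T = ∃ λ r → r < L × Moves (ClosedTrail.walk T) r

  module _ {L} (T : ClosedTrail (suc L)) {m} (m≤L : m ≤ L)
           (stays : ClosedTrail.walk T m ≡ ClosedTrail.walk T (suc m)) where
    open ClosedTrail T

    private
      shift : ∀ r → walk (skip m (suc r)) ≡ walk (suc (skip m r))
      shift = skip-suc walk m stays

      inRange : ∀ {r} → r < L → skip m r < suc L
      inRange {r} r<L = s≤s (≤-trans (skip-≤ m r) r<L)

      movesAt : ∀ {r} → Moves (walk ∘ skip m) r → Moves walk (skip m r)
      movesAt {r} moves e = moves (trans e (sym (shift r)))

      sameStepAt : ∀ {r r′} → SameStep (walk ∘ skip m) r r′ → SameStep walk (skip m r) (skip m r′)
      sameStepAt {r} {r′} =
        subst₂ (λ y y′ → UPairEq _≡_ (walk (skip m r)) y (walk (skip m r′)) y′) (shift r) (shift r′)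

    dropStationaryStep : ClosedTrail L
    dropStationaryStep = record
      { walk   = walk ∘ skip m
      ; closed = trans (cong walk (skip-≥ m≤L)) (trans closed (sym (skip-start walk m stays)))
      ; step   = λ {r} r<L moves → subst (R _) (sym (shift r)) (step (inRange r<L) (movesAt moves))
      ; trail  = λ r<L r′<L moves moves′ same → skip-injective m
          (trail (inRange r<L) (inRange r′<L) (movesAt moves) (movesAt moves′) (sameStepAt same))
      }

    dropStationaryStep-moving : Moving T → Moving dropStationaryStep
    dropStationaryStep-moving (r₀ , r₀≤L , moves₀) with skip-preimage m r₀≢m
      where
      r₀≢m : r₀ ≢ m
      r₀≢m refl = moves₀ stays
    ... | r , skip≡r₀ , bound = r , r<L , moves
      where
      r<L : r < L
      r<L = Sum.[ (λ r<r₀ → <-≤-trans r<r₀ (s≤s⁻¹ r₀≤L)) , (λ r<m → <-≤-trans r<m m≤L) ] bound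
      moves : Moves (walk ∘ skip m) r
      moves e = moves₀ (trans (cong walk (sym skip≡r₀))
                              (trans e (trans (shift r) (cong (walk ∘ suc) skip≡r₀))))

  firstRepeat : ∀ (a : ℕ → V) {L} → 0 < L → a L ≡ a 0 →
    ∃₂ λ p k → suc k + p ≤ L × a (suc k + p) ≡ a p × AllDistinctBelow a (suc k + p)
  firstRepeat a {L} 0<L closed
    with leastBelow (λ q → anyUpTo? (λ p → a p ≟ a q) q) (suc L) (L , n<1+n L , 0 , 0<L , sym closed)
  ... | q , q<L+1 , (p , p<q , ap≡aq) , noEarlier with q ∸ p | m∸n+n≡m (<⇒≤ p<q)
  ...   | zero  | refl = ⊥-elim (<-irrefl refl p<q)
  ...   | suc k | refl = p , k , s≤s⁻¹ q<L+1 , sym ap≡aq , distinct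
    where
    distinct : AllDistinctBelow a q
    distinct {i} {j} i<q j<q ai≡aj with <-cmp i j
    ... | tri< i<j _ _ = ⊥-elim (noEarlier j<q (i , i<j , ai≡aj))
    ... | tri≈ _ i≡j _ = i≡j
    ... | tri> _ _ j<i = ⊥-elim (noEarlier i<q (j , j<i , sym ai≡aj))

  firstReturn⇒cycle : ∀ (a : ℕ → V) p {k} → 3 ≤ k →
    AllDistinctBelow a (k + p) → a (k + p) ≡ a p →
    (∀ {r} → r < k + p → Moves a r → R (a r) (a (suc r))) →
    IsCycle _≡_ R k (λ x → a (toℕ x + p))
  firstReturn⇒cycle a p {k} 3≤k distinct returns step = 3≤k , injective , adjacent
    where
    inSegment : ∀ x → toℕ x + p < k + p
    inSegment x = +-monoˡ-< p (toℕ<n x)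
    injective : ∀ x y → a (toℕ x + p) ≡ a (toℕ y + p) → x ≡ y
    injective x y eq = toℕ-injective (+-cancelʳ-≡ p _ _ (distinct (inSegment x) (inSegment y) eq))
    next : ∀ (x : Fin k) → a (suc (toℕ x + p)) ≡ a (toℕ (cnext x) + p)
    next x with toℕ-cnext x
    ... | inj₁ (_ , toℕ-next)       = cong (λ i → a (i + p)) (sym toℕ-next)
    ... | inj₂ (x+1≡k , toℕ-next) =
      trans (cong (λ i → a (i + p)) x+1≡k) (trans returns (cong (λ i → a (i + p)) (sym toℕ-next)))
    adjacent : ∀ x → R (a (toℕ x + p)) (a (toℕ (cnext x) + p))
    adjacent x = subst (R _) (next x) (step (inSegment x) moves)
      where
      moves : Moves a (toℕ x + p)
      moves e = cnext-≢ (<⇒≤ 3≤k) x (injective x (cnext x) (trans e (next x)))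

  -- At the first repetition a p ≡ a (suc k + p): for k = 0 the step at p is stationary and is dropped,
  -- k = 1 would use the edge a p — a (suc p) twice, and for k ≥ 2 the vertices a p, …, a (k + p)
  -- form a cycle.
  closedTrail⇒cycle : ∀ {L} (T : ClosedTrail L) → Moving T → HasCycle
  closedTrail⇒cycle {zero} T (_ , () , _)
  closedTrail⇒cycle {suc L} T@record { walk = a ; closed = closed ; step = step ; trail = trail } moving
    with firstRepeat a z<s closed
  ... | p , zero , 1+p≤L , returns , _ =
    closedTrail⇒cycle (dropStationaryStep T p≤L stays) (dropStationaryStep-moving T p≤L stays moving)
    where
    p≤L : p ≤ L
    p≤L = s≤s⁻¹ 1+p≤L
    stays : a p ≡ a (suc p)
    stays = sym returns
  ... | p , suc zero , 2+p≤L , returns , distinct =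
    ⊥-elim (1+n≢n (sym (trail (<-trans (n<1+n p) 2+p≤L) 2+p≤L leave back (inj₂ (sym returns , refl)))))
    where
    leave : Moves a p
    leave e = 1+n≢n (sym (distinct (m<n⇒m<1+n (n<1+n p)) (n<1+n (suc p)) e))
    back : Moves a (suc p)
    back e = 1+n≢n (distinct (n<1+n (suc p)) (m<n⇒m<1+n (n<1+n p)) (trans e returns))
  ... | p , suc (suc d) , q≤L , returns , distinct =
    _ , _ , firstReturn⇒cycle a p (s≤s (s≤s (s≤s z≤n))) distinct returns
                              (λ r<q → step (<-≤-trans r<q q≤L))

  record IsCyclicTrail {k} (b : Fin (suc k) → V) : Set where
    field
      step  : ∀ i → b i ≢ b (cnext i) → R (b i) (b (cnext i))
      trail : ∀ {i j} → b i ≢ b (cnext i) → b j ≢ b (cnext j) →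
              UPairEq _≡_ (b i) (b (cnext i)) (b j) (b (cnext j)) → i ≡ j

  cyclicTrail⇒cycle : ∀ {k} {b : Fin (suc k) → V} → IsCyclicTrail b → ∀ {i j} → b i ≢ b j → HasCycle
  cyclicTrail⇒cycle {k} {b} isTrail {i} {j} bi≢bj = closedTrail⇒cycle T moving
    where
    open IsCyclicTrail isTrail
    walk : ℕ → V
    walk = b ∘ cnext-iterate
    T : ClosedTrail (suc k)
    T = record
      { walk   = walk
      ; closed = cong b (cnext-iterate-period k)
      ; step   = λ {r} _ → step (cnext-iterate r)
      ; trail  = λ r<K r′<K moves moves′ same → trans (sym (toℕ-cnext-iterate r<K))
          (trans (cong toℕ (trail moves moves′ same)) (toℕ-cnext-iterate r′<K))
      }
    walk-toℕ : ∀ x → walk (toℕ x) ≡ b x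
    walk-toℕ x = cong b (toℕ-injective (toℕ-cnext-iterate (toℕ<n x)))
    moving : Moving T
    moving with anyUpTo? (λ r → ¬? (walk r ≟ walk (suc r))) (suc k)
    ... | yes found = found
    ... | no none = ⊥-elim (bi≢bj (trans (constantAt i) (sym (constantAt j))))
      where
      constant : ∀ {r} → r ≤ suc k → walk r ≡ walk 0
      constant {zero}  _   = refl
      constant {suc r} r<K =
        trans (sym (decidable-stable (walk r ≟ walk (suc r)) (λ moves → none (r , r<K , moves))))
              (constant (<⇒≤ r<K))
      constantAt : ∀ x → b x ≡ walk 0
      constantAt x = trans (sym (walk-toℕ x)) (constant (<⇒≤ (toℕ<n x)))

AgreeBelow : ∀ {A : Set} {t} → ℕ → Vec A t → Vec A t → Set
AgreeBelow p u v = ∀ j → toℕ j < p → lookup u j ≡ lookup v j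

module _ {A : Set} {t : ℕ} where

  agreeBelow? : DecidableEquality A → ∀ p (u v : Vec A t) → Dec (AgreeBelow p u v)
  agreeBelow? _≟_ p u v = all? (λ j → (toℕ j <? p) →-dec (lookup u j ≟ lookup v j))

  AgreeBelow-sym : ∀ {p} {u v : Vec A t} → AgreeBelow p u v → AgreeBelow p v u
  AgreeBelow-sym uv j j<p = sym (uv j j<p)

  AgreeBelow-trans : ∀ {p} {u v w : Vec A t} → AgreeBelow p u v → AgreeBelow p v w → AgreeBelow p u w
  AgreeBelow-trans uv vw j j<p = trans (uv j j<p) (vw j j<p)

  AgreeBelow-≤ : ∀ {p p′} {u v : Vec A t} → p′ ≤ p → AgreeBelow p u v → AgreeBelow p′ u v
  AgreeBelow-≤ p′≤p uv j j<p′ = uv j (<-≤-trans j<p′ p′≤p)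

  ≡-byPosition : ∀ {u v : Vec A t} s → AgreeBelow (toℕ s) u v → lookup u s ≡ lookup v s →
    (∀ j → s F.< j → lookup u j ≡ lookup v j) → u ≡ v
  ≡-byPosition {u} {v} s below at above =
    trans (sym (tabulate∘lookup u)) (trans (tabulate-cong pointwise) (tabulate∘lookup v))
    where
    pointwise : ∀ j → lookup u j ≡ lookup v j
    pointwise j with <-cmp (toℕ j) (toℕ s)
    ... | tri< j<s _ _ = below j j<s
    ... | tri≈ _ j≡s _ = subst (λ i → lookup u i ≡ lookup v i) (sym (toℕ-injective j≡s)) at
    ... | tri> _ _ s<j = above j s<j

module _ {A : Set} where

  lookup-∷ʳ-fromℕ : ∀ {m} (w : Vec A m) x → lookup (w ∷ʳ x) (fromℕ m) ≡ x
  lookup-∷ʳ-fromℕ []      x = refl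
  lookup-∷ʳ-fromℕ (_ ∷ w) x = lookup-∷ʳ-fromℕ w x

  lookup-∷ʳ-inject₁ : ∀ {m} (w : Vec A m) x j → lookup (w ∷ʳ x) (inject₁ j) ≡ lookup w j
  lookup-∷ʳ-inject₁ (_ ∷ w) x zero    = refl
  lookup-∷ʳ-inject₁ (_ ∷ w) x (suc j) = lookup-∷ʳ-inject₁ w x j

  ∷ʳ-agreeBelow : ∀ {m} (w : Vec A m) x y → AgreeBelow m (w ∷ʳ x) (w ∷ʳ y)
  ∷ʳ-agreeBelow (_ ∷ w) x y zero    _         = refl
  ∷ʳ-agreeBelow (_ ∷ w) x y (suc j) (s≤s j<m) = ∷ʳ-agreeBelow w x y j j<m

module Sierpinski {n : ℕ} (G : SimpleGraph n) where

  ∼-sym : ∀ {t} {u v : Word n t} → _∼_ G u v → _∼_ G v u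
  ∼-sym = EqClosure.symmetric (Linking G)

  Linking⇒∼ : ∀ {t} {u v : Word n t} → Linking G u v → _∼_ G u v
  Linking⇒∼ = return ∘ fwd

  SAdjAt-sym : ∀ {t} {u v : Word n t} {i} → SAdjAt G u v i → SAdjAt G v u i
  SAdjAt-sym (below , differ , adj , above) =
    (λ j j<i → sym (below j j<i)) , differ ∘ sym , SimpleGraph.sym G adj , λ j i<j → Product.swap (above j i<j)

  Linking-sym : ∀ {t} {u v : Word n t} → Linking G u v → Linking G v u
  Linking-sym {u = u} {v} (i , uv , i<last) = i , SAdjAt-sym {u = u} {v} uv , i<last

  SAdjAt-determined : ∀ {t} {x y x′ y′ : Word n t} {s} → SAdjAt G x y s → SAdjAt G x′ y′ s →
    AgreeBelow (toℕ s) x x′ → lookup x s ≡ lookup x′ s → lookup y s ≡ lookup y′ s → x ≡ x′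
  SAdjAt-determined {s = s} (_ , _ , _ , above) (_ , _ , _ , above′) below at-x at-y =
    ≡-byPosition s below at-x λ j s<j →
      trans (proj₁ (above j s<j)) (trans at-y (sym (proj₁ (above′ j s<j))))

  private
    successor : ∀ {t} (i : Fin t) → suc (toℕ i) < t → ∃ λ j → i F.< j
    successor i i+1<t = fromℕ< i+1<t , ≤-reflexive (sym (toℕ-fromℕ< i+1<t))

  -- A linking edge at i′ leaves u with u i′ ≢ u (i′ + 1), whereas an edge at i < i′ forces them equal.
  linkingPosition-minimal : ∀ {t} {u v w : Word n t} {i i′} → SAdjAt G u v i → SAdjAt G u w i′ →
    suc (toℕ i′) < t → ¬ (i F.< i′)
  linkingPosition-minimal {i′ = i′} (_ , _ , _ , above) (_ , differ′ , _ , above′) i′+1<t i<i′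
    with successor i′ i′+1<t
  ... | j , i′<j = differ′ (trans (proj₁ (above i′ i<i′))
                           (trans (sym (proj₁ (above j (<-trans i<i′ i′<j)))) (proj₁ (above′ j i′<j))))

  Linking-functional : ∀ {t} {u v w : Word n t} → Linking G u v → Linking G u w → v ≡ w
  Linking-functional {u = u} {v} {w} (i , uv , i+1<t) (i′ , uw , i′+1<t) with <-cmp (toℕ i) (toℕ i′)
  ... | tri< i<i′ _ _ = ⊥-elim (linkingPosition-minimal {u = u} {v} {w} uv uw i′+1<t i<i′)
  ... | tri> _ _ i′<i = ⊥-elim (linkingPosition-minimal {u = u} {w} {v} uw uv i+1<t i′<i)
  ... | tri≈ _ i≡i′ _ with toℕ-injective i≡i′ | successor i i+1<t | uv | uw
  ...   | refl | j , i<j | below , _ , _ , above | below′ , _ , _ , above′ =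
    SAdjAt-determined {x = v} {u} {w} {u} (SAdjAt-sym {u = u} {v} uv) (SAdjAt-sym {u = u} {w} uw)
      (λ k k<i → trans (sym (below k k<i)) (below′ k k<i))
      (trans (sym (proj₁ (above j i<j))) (proj₁ (above′ j i<j))) refl

  private
    prepend : ∀ {t} {u w v : Word n t} →
      Linking G u w → w ≡ v ⊎ Linking G w v → u ≡ v ⊎ Linking G u v
    prepend uw (inj₁ refl) = inj₂ uw
    prepend {u = u} {w} uw (inj₂ wv) = inj₁ (Linking-functional {u = w} (Linking-sym {u = u} {w} uw) wv)

  ∼⇒≡⊎Linking : ∀ {t} {u v : Word n t} → _∼_ G u v → u ≡ v ⊎ Linking G u v
  ∼⇒≡⊎Linking ε             = inj₁ refl
  ∼⇒≡⊎Linking (fwd uw ◅ wv) = prepend uw (∼⇒≡⊎Linking wv)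
  ∼⇒≡⊎Linking {u = u} (_◅_ {j = w} (bwd wu) wv) =
    prepend (Linking-sym {u = w} {u} wu) (∼⇒≡⊎Linking wv)

  GAdj⇒lastEdge : ∀ {m} {u v : Word n (suc m)} → GAdj G u v →
    ∃₂ λ u′ v′ → _∼_ G u u′ × _∼_ G v v′ × SAdjAt G u′ v′ (fromℕ m)
  GAdj⇒lastEdge {m} (u≁v , u′ , v′ , u∼u′ , v∼v′ , i , u′v′)
    with m<1+n⇒m<n∨m≡n (toℕ<n i)
  ... | inj₁ i<m =
    ⊥-elim (u≁v (u∼u′ ◅◅ Linking⇒∼ {u = u′} {v′} (i , u′v′ , s≤s i<m) ◅◅ ∼-sym v∼v′))
  ... | inj₂ i≡m with toℕ-injective (trans i≡m (sym (toℕ-fromℕ m)))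
  ...   | refl = u′ , v′ , u∼u′ , v∼v′ , u′v′

-- Acyclicity of S[G,t]

firstFailure : ∀ {P : ℕ → Set} → Decidable P → P 0 →
  ∀ n → P n ⊎ ∃ λ q → q < n × P q × ¬ P (suc q)
firstFailure P? P0 zero = inj₁ P0
firstFailure P? P0 (suc n) with firstFailure P? P0 n
... | inj₂ (q , q<n , Pq , ¬Pq+1) = inj₂ (q , m<n⇒m<1+n q<n , Pq , ¬Pq+1)
... | inj₁ Pn with P? (suc n)
...   | yes Pn+1 = inj₁ Pn+1
...   | no ¬Pn+1 = inj₂ (n , n<1+n n , Pn , ¬Pn+1)

module GasketCycle {n} (G : SimpleGraph n) (acyclic : Acyclic _≡_ (Adj G)) {m k : ℕ}
  (c : Fin (suc k) → Word n (suc m)) (isCycle : IsCycle (_∼_ G) (GAdj G) (suc k) c) where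
  open Sierpinski G
  open ClosedTrails F._≟_ (Adj G)

  private
    _≈_ : Word n (suc m) → Word n (suc m) → Set
    _≈_ = _∼_ G

    last : Fin (suc m)
    last = fromℕ m

  classes-injective : ∀ {i j w} → c i ≈ w → c j ≈ w → i ≡ j
  classes-injective ci≈w cj≈w = proj₁ (proj₂ isCycle) _ _ (ci≈w ◅◅ ∼-sym cj≈w)

  edge : ∀ i → ∃₂ λ u v → c i ≈ u × c (cnext i) ≈ v × SAdjAt G u v last
  edge i = GAdj⇒lastEdge (proj₂ (proj₂ isCycle) i)

  U V : Fin (suc k) → Word n (suc m)
  U i = proj₁ (edge i)
  V i = proj₁ (proj₂ (edge i))

  c≈U : ∀ i → c i ≈ U i
  c≈U i = proj₁ (proj₂ (proj₂ (edge i)))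

  cnext≈V : ∀ i → c (cnext i) ≈ V i
  cnext≈V i = proj₁ (proj₂ (proj₂ (proj₂ (edge i))))

  UV-edge : ∀ i → SAdjAt G (U i) (V i) last
  UV-edge i = proj₂ (proj₂ (proj₂ (proj₂ (edge i))))

  UV-agreeBelow : ∀ i → AgreeBelow m (U i) (V i)
  UV-agreeBelow i = AgreeBelow-≤ {u = U i} {V i} (≤-reflexive (sym (toℕ-fromℕ m))) (proj₁ (UV-edge i))

  V≈Unext : ∀ i → V i ≈ U (cnext i)
  V≈Unext i = ∼-sym (cnext≈V i) ◅◅ c≈U (cnext i)

  CommonPrefix : ℕ → Set
  CommonPrefix p = ∀ i → AgreeBelow p (U i) (U zero)

  commonPrefix? : Decidable CommonPrefix
  commonPrefix? p = all? (λ i → agreeBelow? F._≟_ p (U i) (U zero))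

  module _ (common : CommonPrefix m) where

    V≡Unext : ∀ i → V i ≡ U (cnext i)
    V≡Unext i with ∼⇒≡⊎Linking (V≈Unext i)
    ... | inj₁ eq = eq
    ... | inj₂ (s , (_ , differ , _) , s+1<t) =
      ⊥-elim (differ (trans (sym (UV-agreeBelow i s s<m)) (trans (common i s s<m) (sym (common (cnext i) s s<m)))))
      where
      s<m : toℕ s < m
      s<m = s≤s⁻¹ s+1<t

    lastLetter-injective : ∀ i j → lookup (U i) last ≡ lookup (U j) last → i ≡ j
    lastLetter-injective i j eq = classes-injective (c≈U i) (subst (c j ≈_) (sym Ui≡Uj) (c≈U j))
      where
      Ui≡Uj : U i ≡ U j
      Ui≡Uj = ≡-byPosition last
        (AgreeBelow-≤ {u = U i} {U j} (≤-reflexive (toℕ-fromℕ m))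
          (AgreeBelow-trans {u = U i} {U zero} {U j} (common i) (AgreeBelow-sym {u = U j} {U zero} (common j))))
        eq (λ p last<p → ⊥-elim (<⇒≱ last<p (≤fromℕ p)))

    lastLetters-isCycle : IsCycle _≡_ (Adj G) (suc k) (λ i → lookup (U i) last)
    lastLetters-isCycle = proj₁ isCycle , lastLetter-injective , λ i →
      subst (λ w → Adj G (lookup (U i) last) (lookup w last)) (V≡Unext i)
            (proj₁ (proj₂ (proj₂ (UV-edge i))))

  module Divergence (pos : Fin (suc m)) (pos<m : toℕ pos < m)
    (common : CommonPrefix (toℕ pos)) (diverges : ¬ CommonPrefix (suc (toℕ pos))) where

    letter : Fin (suc k) → Fin n
    letter i = lookup (U i) pos

    U≡V-atPos : ∀ i → letter i ≡ lookup (V i) pos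
    U≡V-atPos i = UV-agreeBelow i pos pos<m

    V-common : ∀ i → AgreeBelow (toℕ pos) (V i) (U zero)
    V-common i p p<pos = trans (sym (UV-agreeBelow i p (<-trans p<pos pos<m))) (common i p p<pos)

    linkDetermined : ∀ {x y x′ y′} → SAdjAt G x y pos → SAdjAt G x′ y′ pos →
      AgreeBelow (toℕ pos) x (U zero) → AgreeBelow (toℕ pos) x′ (U zero) →
      lookup x pos ≡ lookup x′ pos → lookup y pos ≡ lookup y′ pos → x ≡ x′
    linkDetermined {x} {y} {x′} {y′} xy x′y′ x-common x′-common = SAdjAt-determined {x = x} {y} {x′} {y′}
      xy x′y′ (λ p p<pos → trans (x-common p p<pos) (sym (x′-common p p<pos)))

    stationaryOrLinked : ∀ i → letter i ≡ letter (cnext i) ⊎ SAdjAt G (V i) (U (cnext i)) pos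
    stationaryOrLinked i with ∼⇒≡⊎Linking (V≈Unext i)
    ... | inj₁ eq = inj₁ (trans (U≡V-atPos i) (cong (λ w → lookup w pos) eq))
    ... | inj₂ (s , link , _) with <-cmp (toℕ s) (toℕ pos)
    ...   | tri< s<pos _ _ =
      ⊥-elim (proj₁ (proj₂ link) (trans (V-common i s s<pos) (sym (common (cnext i) s s<pos))))
    ...   | tri> _ _ pos<s = inj₁ (trans (U≡V-atPos i) (proj₁ link pos pos<s))
    ...   | tri≈ _ s≡pos _ with toℕ-injective s≡pos
    ...     | refl = inj₂ link

    linkedAt : ∀ i → letter i ≢ letter (cnext i) → SAdjAt G (V i) (U (cnext i)) pos
    linkedAt i moves with stationaryOrLinked i
    ... | inj₁ stays = ⊥-elim (moves stays)
    ... | inj₂ link  = link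

    letters-isCyclicTrail : IsCyclicTrail letter
    letters-isCyclicTrail = record { step = step ; trail = trail }
      where
      step : ∀ i → letter i ≢ letter (cnext i) → Adj G (letter i) (letter (cnext i))
      step i moves =
        subst (λ x → Adj G x (letter (cnext i))) (sym (U≡V-atPos i))
              (proj₁ (proj₂ (proj₂ (linkedAt i moves))))
      viaLinks : ∀ {i j w} → V i ≡ w → c (cnext j) ≈ w → i ≡ j
      viaLinks {i} refl cnext≈w = cnext-injective (classes-injective (cnext≈V i) cnext≈w)
      trail : ∀ {i j} → letter i ≢ letter (cnext i) → letter j ≢ letter (cnext j) →
        UPairEq _≡_ (letter i) (letter (cnext i)) (letter j) (letter (cnext j)) → i ≡ j
      trail {i} {j} moves-i moves-j (inj₁ (i≡j , next-i≡next-j)) = viaLinks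
        (linkDetermined {V i} {U (cnext i)} {V j} {U (cnext j)}
          (linkedAt i moves-i) (linkedAt j moves-j) (V-common i) (V-common j)
          (trans (sym (U≡V-atPos i)) (trans i≡j (U≡V-atPos j))) next-i≡next-j)
        (cnext≈V j)
      trail {i} {j} moves-i moves-j (inj₂ (i≡next-j , next-i≡j)) = viaLinks
        (linkDetermined {V i} {U (cnext i)} {U (cnext j)} {V j}
          (linkedAt i moves-i) (SAdjAt-sym {u = V j} {U (cnext j)} (linkedAt j moves-j))
          (V-common i) (common (cnext j))
          (trans (sym (U≡V-atPos i)) i≡next-j) (trans next-i≡j (U≡V-atPos j)))
        (c≈U (cnext j))

    nonconstant : ∃ λ i → letter i ≢ letter zero
    nonconstant = ¬∀⟶∃¬ _ _ (λ i → letter i F.≟ letter zero) λ constant → diverges λ i p p<pos+1 →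
      Sum.[ common i p , (λ p≡pos → subst (λ x → lookup (U i) x ≡ lookup (U zero) x)
                                          (sym (toℕ-injective p≡pos)) (constant i)) ]
        (m<1+n⇒m<n∨m≡n p<pos+1)

    cycle : HasCycle
    cycle = cyclicTrail⇒cycle letters-isCyclicTrail (proj₂ nonconstant)

  absurd : ⊥
  absurd with firstFailure commonPrefix? (λ _ _ ()) m
  ... | inj₁ common = acyclic _ _ (lastLetters-isCycle common)
  ... | inj₂ (q , q<m , common , diverges)
    with fromℕ< (m<n⇒m<1+n q<m) | toℕ-fromℕ< (m<n⇒m<1+n q<m)
  ...   | pos | refl = let k′ , c′ , isCycle′ = Divergence.cycle pos q<m common diverges in
                       acyclic k′ c′ isCycle′

gasket-acyclic : ∀ {n} (G : SimpleGraph n) → Acyclic _≡_ (Adj G) →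
  ∀ t → 1 ≤ t → Acyclic (_∼_ G {t}) (GAdj G {t})
gasket-acyclic G acyclic (suc m) _ zero    c (() , _)
gasket-acyclic G acyclic (suc m) _ (suc k) c isCycle = GasketCycle.absurd G acyclic c isCycle

-- Copies of G in S[G,t]

module _ {V W : Set} {_≈V_ : V → V → Set} {_≈W_ : W → W → Set}
         (f : V → W) (reflects : ∀ {x y} → f x ≈W f y → x ≈V y) where

  IsCycle-map : ∀ {RV : V → V → Set} {RW : W → W → Set} → (∀ {x y} → RV x y → RW (f x) (f y)) →
    ∀ {k c} → IsCycle _≈V_ RV k c → IsCycle _≈W_ RW k (f ∘ c)
  IsCycle-map preserves (3≤k , distinct , adjacent) =
    3≤k , (λ i j → distinct i j ∘ reflects) , preserves ∘ adjacent

  SameCycle-reflect : ∀ {k} {c d : Fin k → V} → SameCycle _≈W_ (f ∘ c) (f ∘ d) → SameCycle _≈V_ c d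
  SameCycle-reflect {c = c} {d} (forth , back) =
    (λ i → let j , p = forth i in j , reflectPair (c i) (c (cnext i)) (d j) (d (cnext j)) p) ,
    (λ j → let i , p = back j in i , reflectPair (d j) (d (cnext j)) (c i) (c (cnext i)) p)
    where
    reflectPair : ∀ a b a′ b′ → UPairEq _≈W_ (f a) (f b) (f a′) (f b′) → UPairEq _≈V_ a b a′ b′
    reflectPair _ _ _ _ = Sum.map (Product.map reflects reflects) (Product.map reflects reflects)

SameCycle⇒vertexMatch : ∀ {V : Set} {_≈_ : V → V → Set} {k} {c d : Fin k → V} →
  SameCycle _≈_ c d → ∀ i → ∃ λ j → c i ≈ d j
SameCycle⇒vertexMatch (forth , _) i with forth i
... | j , inj₁ (ci≈dj , _)  = j , ci≈dj
... | j , inj₂ (ci≈dj′ , _) = cnext j , ci≈dj′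

injective-¬intoPair : ∀ {A : Set} {k} → 2 < k → (f : Fin k → A) → (∀ i j → f i ≡ f j → i ≡ j) →
  ∀ a b → ¬ (∀ i → f i ≡ a ⊎ f i ≡ b)
injective-¬intoPair {A} 2<k f f-injective a b into =
  let i , j , i<j , sameSide = pigeonhole 2<k (side ∘ into) in
  <⇒≢ i<j (cong toℕ (f-injective i j (equal (into i) (into j) sameSide)))
  where
  side : ∀ {x : A} → x ≡ a ⊎ x ≡ b → Fin 2
  side = Sum.[ (λ _ → zero) , (λ _ → suc zero) ]
  equal : ∀ {x y} (p : x ≡ a ⊎ x ≡ b) (q : y ≡ a ⊎ y ≡ b) → side p ≡ side q → x ≡ y
  equal (inj₁ x≡a) (inj₁ y≡a) _ = trans x≡a (sym y≡a)
  equal (inj₂ x≡b) (inj₂ y≡b) _ = trans x≡b (sym y≡b)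

module Copies {n : ℕ} (G : SimpleGraph n) where
  open Sierpinski G

  copy : ∀ {m} → Word n m → Fin n → Word n (suc m)
  copy w x = w ∷ʳ x

  copy-∼⇒≡ : ∀ {m} (w : Word n m) {x y} → _∼_ G (copy w x) (copy w y) → x ≡ y
  copy-∼⇒≡ w {x} {y} r with ∼⇒≡⊎Linking r
  ... | inj₁ eq = ∷ʳ-injectiveʳ w w eq
  ... | inj₂ (s , (_ , differ , _) , s+1<t) = ⊥-elim (differ (∷ʳ-agreeBelow w x y s (s≤s⁻¹ s+1<t)))

  copy-GAdj : ∀ {m} (w : Word n m) {x y} → Adj G x y → GAdj G (copy w x) (copy w y)
  copy-GAdj {m} w {x} {y} adj = x≁y , copy w x , copy w y , ε , ε , fromℕ m , lastEdge
    where
    x≢y : x ≢ y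
    x≢y refl = irrefl G adj
    x≁y : ¬ _∼_ G (copy w x) (copy w y)
    x≁y = x≢y ∘ copy-∼⇒≡ w
    lastEdge : SAdjAt G (copy w x) (copy w y) (fromℕ m)
    lastEdge = AgreeBelow-≤ {u = copy w x} {copy w y} (≤-reflexive (toℕ-fromℕ m)) (∷ʳ-agreeBelow w x y)
             , (λ eq → x≢y (trans (sym (lookup-∷ʳ-fromℕ w x)) (trans eq (lookup-∷ʳ-fromℕ w y))))
             , subst₂ (Adj G) (sym (lookup-∷ʳ-fromℕ w x)) (sym (lookup-∷ʳ-fromℕ w y)) adj
             , λ j last<j → ⊥-elim (<⇒≱ last<j (≤fromℕ j))

  -- Along a linking edge at s every letter of copy w x after position s equals the letter of copy w′ y
  -- at s, so x repeats the last letter of w (if s is earlier) or of w′ (if s is the penultimate position).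
  ∼-acrossCopies : ∀ {m} {w w′ : Word n (suc m)} {x y} → w ≢ w′ → _∼_ G (copy w x) (copy w′ y) →
    x ≡ lookup w (fromℕ m) ⊎ x ≡ lookup w′ (fromℕ m)
  ∼-acrossCopies {m} {w} {w′} {x} {y} w≢w′ r with ∼⇒≡⊎Linking r
  ... | inj₁ eq = ⊥-elim (w≢w′ (∷ʳ-injectiveˡ w w′ eq))
  ... | inj₂ (s , (_ , _ , _ , above) , s+1<t) = byPosition (<-cmp (toℕ s) m)
    where
    s≤m : toℕ s ≤ m
    s≤m = s≤s⁻¹ (s≤s⁻¹ s+1<t)
    penultimate : Fin (suc (suc m))
    penultimate = inject₁ (fromℕ m)
    toℕ-penultimate : toℕ penultimate ≡ m
    toℕ-penultimate = trans (toℕ-inject₁ (fromℕ m)) (toℕ-fromℕ m)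
    x≡ys : x ≡ lookup (copy w′ y) s
    x≡ys = trans (sym (lookup-∷ʳ-fromℕ w x))
                 (proj₁ (above (fromℕ (suc m)) (s≤s (subst (toℕ s ≤_) (sym (toℕ-fromℕ m)) s≤m))))
    byPosition : Tri (toℕ s < m) (toℕ s ≡ m) (m < toℕ s) →
      x ≡ lookup w (fromℕ m) ⊎ x ≡ lookup w′ (fromℕ m)
    byPosition (tri< s<m _ _) = inj₁ (trans x≡ys (trans (sym (proj₁ (above penultimate s<penultimate)))
                                                          (lookup-∷ʳ-inject₁ w x (fromℕ m))))
      where
      s<penultimate : toℕ s < toℕ penultimate
      s<penultimate = subst (toℕ s <_) (sym toℕ-penultimate) s<m
    byPosition (tri≈ _ s≡m _) = inj₂ (trans x≡ys (trans (cong (lookup (copy w′ y)) s≡penultimate)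
                                                          (lookup-∷ʳ-inject₁ w′ y (fromℕ m))))
      where
      s≡penultimate : s ≡ penultimate
      s≡penultimate = toℕ-injective (trans s≡m (sym toℕ-penultimate))
    byPosition (tri> _ _ m<s) = ⊥-elim (<-irrefl refl (<-≤-trans m<s s≤m))

  lifts-sameCopy : ∀ {m k} {c d : Fin k → Fin n} {w w′ : Word n m} → IsCycle _≡_ (Adj G) k c →
    SameCycle (_∼_ G) (copy w ∘ c) (copy w′ ∘ d) → w ≡ w′
  lifts-sameCopy {w = w} {w′} isCycle same with ≡-dec F._≟_ w w′
  ... | yes w≡w′ = w≡w′
  lifts-sameCopy {zero}  {w = []} {[]} _ _ | no w≢w′ = ⊥-elim (w≢w′ refl)
  lifts-sameCopy {suc m} {c = c} {d} {w} {w′} (2<k , c-injective , _) same | no w≢w′ =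
    ⊥-elim (injective-¬intoPair 2<k c c-injective (lookup w (fromℕ m)) (lookup w′ (fromℕ m)) intoPair)
    where
    intoPair : ∀ i → c i ≡ lookup w (fromℕ m) ⊎ c i ≡ lookup w′ (fromℕ m)
    intoPair i =
      let j , ci∼dj = SameCycle⇒vertexMatch {_≈_ = _∼_ G} {c = copy w ∘ c} {copy w′ ∘ d} same i
      in ∼-acrossCopies {x = c i} {d j} w≢w′ ci∼dj

toWord : ∀ {n} m → Fin (n ^ m) → Word n m
toWord     zero    _ = []
toWord {n} (suc m) i = let x , j = F.remQuot {n} (n ^ m) i in x ∷ toWord m j

remQuot-injective : ∀ {l} k {i j : Fin (l * k)} → F.remQuot k i ≡ F.remQuot k j → i ≡ j
remQuot-injective {l} k {i} {j} eq =
  trans (sym (combine-remQuot {l} k i))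
        (trans (cong (Product.uncurry (F.combine {l} {k})) eq) (combine-remQuot {l} k j))

toWord-injective : ∀ {n} m {i j : Fin (n ^ m)} → toWord m i ≡ toWord m j → i ≡ j
toWord-injective     zero    {zero} {zero} _ = refl
toWord-injective {n} (suc m) eq =
  remQuot-injective {n} (n ^ m) (cong₂ _,_ (∷-injectiveˡ eq) (toWord-injective m (∷-injectiveʳ eq)))

gasket-cycles : ∀ {n} (G : SimpleGraph n) (k l : ℕ) → HasDistinctCycles _≡_ (Adj G) k l →
  ∀ t → 1 ≤ t → HasDistinctCycles (_∼_ G {t}) (GAdj G {t}) k (l * n ^ (t ∸ 1))
gasket-cycles {n} G k l (cs , isCycle , distinct) (suc m) _ = lifted , lifted-isCycle , lifted-distinct
  where
  open Copies G
  cycleOf : Fin (l * n ^ m) → Fin l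
  cycleOf a = proj₁ (F.remQuot {l} (n ^ m) a)
  copyOf : Fin (l * n ^ m) → Word n m
  copyOf a = toWord m (proj₂ (F.remQuot {l} (n ^ m) a))
  lifted : Fin (l * n ^ m) → Fin k → Word n (suc m)
  lifted a = copy (copyOf a) ∘ cs (cycleOf a)
  lifted-isCycle : ∀ a → IsCycle (_∼_ G) (GAdj G) k (lifted a)
  lifted-isCycle a =
    IsCycle-map {_≈W_ = _∼_ G} (copy (copyOf a)) (copy-∼⇒≡ (copyOf a))
      {RW = GAdj G} (copy-GAdj (copyOf a))
      {c = cs (cycleOf a)} (isCycle (cycleOf a))
  lifted-distinct : ∀ a b → SameCycle (_∼_ G) (lifted a) (lifted b) → a ≡ b
  lifted-distinct a b same = remQuot-injective {l} (n ^ m) (cong₂ _,_ sameCycle (toWord-injective m sameCopy))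
    where
    sameCopy : copyOf a ≡ copyOf b
    sameCopy = lifts-sameCopy (isCycle (cycleOf a)) same
    sameCycle : cycleOf a ≡ cycleOf b
    sameCycle = distinct _ _
      (SameCycle-reflect {_≈W_ = _∼_ G} (copy (copyOf a)) (copy-∼⇒≡ (copyOf a))
        {c = cs (cycleOf a)} {cs (cycleOf b)}
        (subst (λ w → SameCycle (_∼_ G) (lifted a) (copy w ∘ cs (cycleOf b))) (sym sameCopy) same))

mainTheorem8 : ∀ {n : ℕ} (G : SimpleGraph n) → 2 ≤ n →
    (Acyclic _≡_ (Adj G) →
       ∀ (t : ℕ) → 1 ≤ t → Acyclic (_∼_ G {t}) (GAdj G {t}))
    ×
    (∀ (k l : ℕ) → HasDistinctCycles _≡_ (Adj G) k l →
       ∀ (t : ℕ) → 1 ≤ t →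
         HasDistinctCycles (_∼_ G {t}) (GAdj G {t}) k (l * n ^ (t ∸ 1)))
mainTheorem8 G _ = gasket-acyclic G , gasket-cycles G
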